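{- Let $n$ and $\delta$ be positive integers, and for each integer $s$ with $\delta \leq s \leq \lfloor n/2 \rfloor$ let $G_s = K_s \vee (K_{n-2s} + \overline{K_s})$. Then: (i) if $n > 6\delta+2$ or $n = 6\delta+1$, then $e(G_\delta) > e(G_s)$ for every integer $s$ with $\delta < s \leq \lfloor n/2 \rfloor$; (ii) if $n = 6\delta+2$ or $n = 6\delta-1$, then $e(G_\delta) = e(G_{\lfloor n/2 \rfloor}) > e(G_s)$ for every integer $s$ with $\delta < s < \lfloor n/2 \rfloor$; (iii) if $n < 6\delta-1$ or $n = 6\delta$, then $e(G_{\lfloor n/2 \rfloor}) > e(G_s)$ for every integer $s$ with $\delta \leq s < \lfloor n/2 \rfloor$.
   Context: $e(G)$ denotes the number of edges of a graph $G$. $K_m$ is the complete graph on $m$ vertices ($K_0$ is the null graph with no vertices), $\overline{K_m}$ is the edgeless graph on $m$ vertices, $G_1 + G_2$ is the disjoint union and $G_1 \vee G_2$ is the join (disjoint union plus all edges between $V(G_1)$ and $V(G_2)$). -}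

module Defs where

open import Data.Nat using (ℕ; _+_; _*_; _∸_; _<ᵇ_)
open import Data.Bool using (Bool; true; false; not; _∧_; if_then_else_)
open import Data.Fin using (Fin; toℕ; splitAt; _≟_)
open import Data.Sum using (inj₁; inj₂)
open import Data.List using (List; map; allFin)
open import Data.Nat.ListAction using (sum)
open import Relation.Nullary.Decidable using (⌊_⌋)

-- A finite simple graph on vertex set Fin V, given by a (symmetric,
-- irreflexive by construction below) Boolean adjacency relation.
record Graph : Set where
  constructor graph
  field
    V   : ℕ
    Adj : Fin V → Fin V → Bool
open Graph public

e : Graph → ℕ
e G = sum (map (λ i → sum (map (λ j → if (toℕ i <ᵇ toℕ j) ∧ Adj G i j then 1 else 0)
                               (allFin (V G))))
               (allFin (V G)))

K : ℕ → Graph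
K m = graph m (λ i j → not ⌊ i ≟ j ⌋)

Kbar : ℕ → Graph
Kbar m = graph m (λ _ _ → false)

_⊕_ : Graph → Graph → Graph
G₁ ⊕ G₂ = graph (V G₁ + V G₂) adj
  where
  adj : Fin (V G₁ + V G₂) → Fin (V G₁ + V G₂) → Bool
  adj x y with splitAt (V G₁) x | splitAt (V G₁) y
  ... | inj₁ a | inj₁ b = Adj G₁ a b
  ... | inj₂ a | inj₂ b = Adj G₂ a b
  ... | _      | _      = false

_∨G_ : Graph → Graph → Graph
G₁ ∨G G₂ = graph (V G₁ + V G₂) adj
  where
  adj : Fin (V G₁ + V G₂) → Fin (V G₁ + V G₂) → Bool
  adj x y with splitAt (V G₁) x | splitAt (V G₁) y
  ... | inj₁ a | inj₁ b = Adj G₁ a b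
  ... | inj₂ a | inj₂ b = Adj G₂ a b
  ... | _      | _      = true

-- G_s = K_s ∨ (K_{n-2s} + \overline{K_s})  (used only for s ≤ ⌊n/2⌋)
Gs : ℕ → ℕ → Graph
Gs n s = K s ∨G (K (n ∸ 2 * s) ⊕ Kbar s)

{-# OPTIONS --safe #-}
-- With c = n − 2s, the graph G_s has C(s,2) + C(c,2) + s(c + s) edges, i.e.
-- 2e(G_s) = n² − n + s(3s + 1) − 2ns, a convex quadratic in s.  Hence for s < t,
-- 2e(G_t) − 2e(G_s) = (t − s)(3(s + t) + 1 − 2n): on δ ≤ s ≤ ⌊n/2⌋ the maximum is
-- attained at an endpoint, and which endpoint wins is decided by the sign of
-- 3(δ + ⌊n/2⌋) + 1 − 2n.  The three cases of the statement are exactly its three signs.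
module Submission where

open import Defs
open import Algebra.Properties.CommutativeMonoid.Sum as Sum using ()
open import Data.Bool using (Bool; true; false; _∧_; if_then_else_)
open import Data.Bool.Properties using (∧-zeroʳ; T-≡)
open import Data.Fin using (Fin; zero; suc; toℕ; _↑ˡ_; _↑ʳ_; _≟_)
open import Data.Fin.Properties using (splitAt-↑ˡ; splitAt-↑ʳ; toℕ-↑ˡ; toℕ-↑ʳ; toℕ<n)
open import Data.List using (map; allFin; tabulate; _∷_; [])
open import Data.List.Properties using (map-tabulate)
import Data.Nat.ListAction as List
open import Data.Nat using (ℕ; zero; suc; pred; _+_; _*_; _∸_; _<_; _≤_; _/_; _%_; _<ᵇ_; z≤n; s≤s; >-nonZero)
open import Data.Nat.DivMod using (m/n*n≤m; m≡m%n+[m/n]*n; m%n<n)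
open import Data.Nat.Properties
  using ( +-0-commutativeMonoid; +-comm; +-assoc; +-identityʳ; *-comm; *-identityˡ; *-identityʳ
        ; ≤-refl; ≤-reflexive; ≤-trans; ≤-antisym; <-≤-trans; ≤-<-trans; <⇒≤; m<1+n⇒m≤n; <⇒<ᵇ
        ; m≤m+n; m+n∸m≡n; m≤n⇒∃[o]m+o≡n; m<n⇒0<n∸m
        ; +-mono-≤; +-mono-<-≤; +-monoˡ-≤; +-monoˡ-<; +-monoʳ-<; *-monoʳ-≤; *-monoʳ-<
        ; +-cancelʳ-≡; +-cancelʳ-<; *-cancelˡ-≡; *-cancelˡ-<
        ; module ≤-Reasoning )
open import Data.Nat.Tactic.RingSolver using (solve)
open import Data.Product using (_×_; _,_)
open import Data.Sum using (_⊎_; inj₁; inj₂)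
open import Function.Bundles using (Equivalence)
open import Relation.Binary.PropositionalEquality
open import Relation.Nullary using (yes; no)

open Sum +-0-commutativeMonoid using (sum; sum-syntax; sum-cong-≗; ∑-distrib-+; sum-replicate-zero)

𝟙 : Bool → ℕ
𝟙 b = if b then 1 else 0

∑-const : ∀ n c → ∑[ i < n ] c ≡ n * c
∑-const zero    c = refl
∑-const (suc n) c = cong (c +_) (∑-const n c)

∑-↑ : ∀ a b (f : Fin (a + b) → ℕ) → sum f ≡ ∑[ i < a ] f (i ↑ˡ b) + ∑[ j < b ] f (a ↑ʳ j)
∑-↑ zero    b f = refl
∑-↑ (suc a) b f = trans (cong (f zero +_) (∑-↑ a b (λ k → f (suc k)))) (sym (+-assoc (f zero) _ _))

∑∑-↑ : ∀ a b (f : Fin (a + b) → Fin (a + b) → ℕ) →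
  ∑[ k < a + b ] ∑[ l < a + b ] f k l ≡
    (∑[ i < a ] ∑[ j < a ] f (i ↑ˡ b) (j ↑ˡ b) + ∑[ i < a ] ∑[ j < b ] f (i ↑ˡ b) (a ↑ʳ j))
  + (∑[ i < b ] ∑[ j < a ] f (a ↑ʳ i) (j ↑ˡ b) + ∑[ i < b ] ∑[ j < b ] f (a ↑ʳ i) (a ↑ʳ j))
∑∑-↑ a b f = trans (∑-↑ a b _) (cong₂ _+_ (rows (λ i → f (i ↑ˡ b))) (rows (λ i → f (a ↑ʳ i))))
  where
  rows : ∀ {r} (g : Fin r → Fin (a + b) → ℕ) →
    ∑[ i < r ] sum (g i) ≡ ∑[ i < r ] ∑[ j < a ] g i (j ↑ˡ b) + ∑[ i < r ] ∑[ j < b ] g i (a ↑ʳ j)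
  rows g = trans (sum-cong-≗ (λ i → ∑-↑ a b (g i)))
    (∑-distrib-+ (λ i → ∑[ j < a ] g i (j ↑ˡ b)) (λ i → ∑[ j < b ] g i (a ↑ʳ j)))

∑∑-≡0 : ∀ a b {f : Fin a → Fin b → ℕ} → (∀ i j → f i j ≡ 0) → ∑[ i < a ] ∑[ j < b ] f i j ≡ 0
∑∑-≡0 a b f≡0 = trans (sum-cong-≗ (λ i → trans (sum-cong-≗ (f≡0 i)) (sum-replicate-zero b))) (sum-replicate-zero a)

∑∑-≡1 : ∀ a b {f : Fin a → Fin b → ℕ} → (∀ i j → f i j ≡ 1) → ∑[ i < a ] ∑[ j < b ] f i j ≡ a * b
∑∑-≡1 a b f≡1 = trans (sum-cong-≗ (λ i → trans (sum-cong-≗ (f≡1 i)) (trans (∑-const b 1) (*-identityʳ b)))) (∑-const a b)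

sum-tabulate : ∀ n (f : Fin n → ℕ) → List.sum (tabulate f) ≡ sum f
sum-tabulate zero    f = refl
sum-tabulate (suc n) f = cong (f zero +_) (sum-tabulate n (λ i → f (suc i)))

sum-map-allFin : ∀ n (f : Fin n → ℕ) → List.sum (map f (allFin n)) ≡ sum f
sum-map-allFin n f = trans (cong List.sum (map-tabulate (λ i → i) f)) (sum-tabulate n f)

m<n⇒m<ᵇn≡true : ∀ {m n} → m < n → (m <ᵇ n) ≡ true
m<n⇒m<ᵇn≡true m<n = Equivalence.to T-≡ (<⇒<ᵇ m<n)

n≤m⇒m<ᵇn≡false : ∀ {m n} → n ≤ m → (m <ᵇ n) ≡ false
n≤m⇒m<ᵇn≡false z≤n       = refl
n≤m⇒m<ᵇn≡false (s≤s n≤m) = n≤m⇒m<ᵇn≡false n≤m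

+-cancelˡ-<ᵇ : ∀ a m n → (a + m <ᵇ a + n) ≡ (m <ᵇ n)
+-cancelˡ-<ᵇ zero    m n = refl
+-cancelˡ-<ᵇ (suc a) m n = +-cancelˡ-<ᵇ a m n

edgeCount : (n : ℕ) → (Fin n → Fin n → Bool) → ℕ
edgeCount n A = ∑[ i < n ] ∑[ j < n ] 𝟙 ((toℕ i <ᵇ toℕ j) ∧ A i j)

e≡edgeCount : ∀ G → e G ≡ edgeCount (V G) (Adj G)
e≡edgeCount G = trans (sum-map-allFin (V G) _) (sum-cong-≗ (λ i → sum-map-allFin (V G) (λ j → 𝟙 ((toℕ i <ᵇ toℕ j) ∧ Adj G i j))))

edgeCount-cong : ∀ n {A B : Fin n → Fin n → Bool} → (∀ i j → A i j ≡ B i j) → edgeCount n A ≡ edgeCount n B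
edgeCount-cong n A≡B = sum-cong-≗ (λ i → sum-cong-≗ (λ j → cong (λ b → 𝟙 ((toℕ i <ᵇ toℕ j) ∧ b)) (A≡B i j)))

edgeCount-+ : ∀ a b (A : Fin (a + b) → Fin (a + b) → Bool) →
  edgeCount (a + b) A ≡ edgeCount a (λ i j → A (i ↑ˡ b) (j ↑ˡ b))
                      + ∑[ i < a ] ∑[ j < b ] 𝟙 (A (i ↑ˡ b) (a ↑ʳ j))
                      + edgeCount b (λ i j → A (a ↑ʳ i) (a ↑ʳ j))
edgeCount-+ a b A =
  trans (∑∑-↑ a b cell) (cong₂ _+_ (cong₂ _+_ (blocks ll) (blocks lr)) (cong₂ _+_ (∑∑-≡0 b a rl) (blocks rr)))
  where
  cell : Fin (a + b) → Fin (a + b) → ℕ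
  cell x y = 𝟙 ((toℕ x <ᵇ toℕ y) ∧ A x y)
  same-order : ∀ {x y} → x ≡ y → ∀ c → 𝟙 (x ∧ c) ≡ 𝟙 (y ∧ c)
  same-order x≡y c = cong (λ x → 𝟙 (x ∧ c)) x≡y
  blocks : ∀ {r s} {f g : Fin r → Fin s → ℕ} → (∀ i j → f i j ≡ g i j) →
    ∑[ i < r ] ∑[ j < s ] f i j ≡ ∑[ i < r ] ∑[ j < s ] g i j
  blocks f≡g = sum-cong-≗ (λ i → sum-cong-≗ (f≡g i))
  ll : ∀ i j → cell (i ↑ˡ b) (j ↑ˡ b) ≡ 𝟙 ((toℕ i <ᵇ toℕ j) ∧ A (i ↑ˡ b) (j ↑ˡ b))
  ll i j = same-order (cong₂ _<ᵇ_ (toℕ-↑ˡ i b) (toℕ-↑ˡ j b)) _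
  lr : ∀ i j → cell (i ↑ˡ b) (a ↑ʳ j) ≡ 𝟙 (A (i ↑ˡ b) (a ↑ʳ j))
  lr i j = same-order (trans (cong₂ _<ᵇ_ (toℕ-↑ˡ i b) (toℕ-↑ʳ a j))
                             (m<n⇒m<ᵇn≡true (≤-trans (toℕ<n i) (m≤m+n a (toℕ j))))) _
  rl : ∀ i j → cell (a ↑ʳ i) (j ↑ˡ b) ≡ 0
  rl i j = same-order (trans (cong₂ _<ᵇ_ (toℕ-↑ʳ a i) (toℕ-↑ˡ j b))
                             (n≤m⇒m<ᵇn≡false (≤-trans (<⇒≤ (toℕ<n j)) (m≤m+n a (toℕ i))))) _
  rr : ∀ i j → cell (a ↑ʳ i) (a ↑ʳ j) ≡ 𝟙 ((toℕ i <ᵇ toℕ j) ∧ A (a ↑ʳ i) (a ↑ʳ j))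
  rr i j = same-order (trans (cong₂ _<ᵇ_ (toℕ-↑ʳ a i) (toℕ-↑ʳ a j)) (+-cancelˡ-<ᵇ a (toℕ i) (toℕ j))) _

module _ (G₁ G₂ : Graph) where

  e-blocks : (A : Fin (V G₁ + V G₂) → Fin (V G₁ + V G₂) → Bool) →
    (∀ i j → A (i ↑ˡ V G₂) (j ↑ˡ V G₂) ≡ Adj G₁ i j) →
    (∀ i j → A (V G₁ ↑ʳ i) (V G₁ ↑ʳ j) ≡ Adj G₂ i j) →
    e (graph (V G₁ + V G₂) A) ≡ e G₁ + ∑[ i < V G₁ ] ∑[ j < V G₂ ] 𝟙 (A (i ↑ˡ V G₂) (V G₁ ↑ʳ j)) + e G₂
  e-blocks A A₁≡ A₂≡ =
    trans (e≡edgeCount (graph (V G₁ + V G₂) A))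
      (trans (edgeCount-+ (V G₁) (V G₂) A) (cong₂ (λ x y → x + cross + y) (restrict G₁ A₁≡) (restrict G₂ A₂≡)))
    where
    cross : ℕ
    cross = ∑[ i < V G₁ ] ∑[ j < V G₂ ] 𝟙 (A (i ↑ˡ V G₂) (V G₁ ↑ʳ j))
    restrict : ∀ G {A′} → (∀ i j → A′ i j ≡ Adj G i j) → edgeCount (V G) A′ ≡ e G
    restrict G A′≡ = trans (edgeCount-cong (V G) A′≡) (sym (e≡edgeCount G))

  e-∨G : e (G₁ ∨G G₂) ≡ e G₁ + V G₁ * V G₂ + e G₂
  e-∨G = trans (e-blocks (Adj (G₁ ∨G G₂)) ll rr) (cong (λ x → e G₁ + x + e G₂) (∑∑-≡1 (V G₁) (V G₂) lr))
    where
    ll : ∀ i j → Adj (G₁ ∨G G₂) (i ↑ˡ V G₂) (j ↑ˡ V G₂) ≡ Adj G₁ i j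
    ll i j rewrite splitAt-↑ˡ (V G₁) i (V G₂) | splitAt-↑ˡ (V G₁) j (V G₂) = refl
    rr : ∀ i j → Adj (G₁ ∨G G₂) (V G₁ ↑ʳ i) (V G₁ ↑ʳ j) ≡ Adj G₂ i j
    rr i j rewrite splitAt-↑ʳ (V G₁) (V G₂) i | splitAt-↑ʳ (V G₁) (V G₂) j = refl
    lr : ∀ i j → 𝟙 (Adj (G₁ ∨G G₂) (i ↑ˡ V G₂) (V G₁ ↑ʳ j)) ≡ 1
    lr i j rewrite splitAt-↑ˡ (V G₁) i (V G₂) | splitAt-↑ʳ (V G₁) (V G₂) j = refl

  e-⊕ : e (G₁ ⊕ G₂) ≡ e G₁ + e G₂
  e-⊕ = begin
      e (G₁ ⊕ G₂)                ≡⟨ e-blocks (Adj (G₁ ⊕ G₂)) ll rr ⟩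
      e G₁ + _ + e G₂            ≡⟨ cong (λ x → e G₁ + x + e G₂) (∑∑-≡0 (V G₁) (V G₂) lr) ⟩
      e G₁ + 0 + e G₂            ≡⟨ cong (_+ e G₂) (+-identityʳ (e G₁)) ⟩
      e G₁ + e G₂                ∎
    where
    ll : ∀ i j → Adj (G₁ ⊕ G₂) (i ↑ˡ V G₂) (j ↑ˡ V G₂) ≡ Adj G₁ i j
    ll i j rewrite splitAt-↑ˡ (V G₁) i (V G₂) | splitAt-↑ˡ (V G₁) j (V G₂) = refl
    rr : ∀ i j → Adj (G₁ ⊕ G₂) (V G₁ ↑ʳ i) (V G₁ ↑ʳ j) ≡ Adj G₂ i j
    rr i j rewrite splitAt-↑ʳ (V G₁) (V G₂) i | splitAt-↑ʳ (V G₁) (V G₂) j = refl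
    lr : ∀ i j → 𝟙 (Adj (G₁ ⊕ G₂) (i ↑ˡ V G₂) (V G₁ ↑ʳ j)) ≡ 0
    lr i j rewrite splitAt-↑ˡ (V G₁) i (V G₂) | splitAt-↑ʳ (V G₁) (V G₂) j = refl
    open ≡-Reasoning

e-Kbar : ∀ m → e (Kbar m) ≡ 0
e-Kbar m = trans (e≡edgeCount (Kbar m)) (∑∑-≡0 m m (λ i j → cong 𝟙 (∧-zeroʳ (toℕ i <ᵇ toℕ j))))

e-K-suc : ∀ m → e (K (suc m)) ≡ m + e (K m)
e-K-suc m = trans (e≡edgeCount (K (suc m))) (trans (edgeCount-+ 1 m (Adj (K (suc m))))
  (cong₂ _+_ (trans (∑∑-≡1 1 m (λ _ _ → refl)) (*-identityˡ m)) (trans (edgeCount-cong m adj-suc) (sym (e≡edgeCount (K m))))))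
  where
  adj-suc : ∀ i j → Adj (K (suc m)) (suc i) (suc j) ≡ Adj (K m) i j
  adj-suc i j with i ≟ j
  ... | yes _ = refl
  ... | no  _ = refl

e-K : ∀ m → 2 * e (K m) + m ≡ m * m
e-K zero    = refl
e-K (suc m) = trans (cong (λ x → 2 * x + suc m) (e-K-suc m)) (next-square (e (K m)) (e-K m))
  where
  open ≡-Reasoning
  next-square : ∀ x → 2 * x + m ≡ m * m → 2 * (m + x) + suc m ≡ suc m * suc m
  next-square x 2x+m≡m² = begin
    2 * (m + x) + suc m        ≡⟨ solve (m ∷ x ∷ []) ⟩
    (2 * x + m) + (2 * m + 1)  ≡⟨ cong (_+ (2 * m + 1)) 2x+m≡m² ⟩
    m * m + (2 * m + 1)        ≡⟨ solve (m ∷ []) ⟩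
    suc m * suc m              ∎

e-Gs-parts : ∀ s c → e (Gs (2 * s + c) s) ≡ e (K s) + s * (c + s) + e (K c)
e-Gs-parts s c rewrite m+n∸m≡n (2 * s) c =
  trans (e-∨G (K s) (K c ⊕ Kbar s))
        (cong (e (K s) + s * (c + s) +_) (trans (e-⊕ (K c) (Kbar s)) (trans (cong (e (K c) +_) (e-Kbar s)) (+-identityʳ (e (K c))))))

e-Gs : ∀ {n s} → 2 * s ≤ n → 2 * e (Gs n s) + 2 * n * s + n ≡ n * n + s * (3 * s + 1)
e-Gs {s = s} 2s≤n with m≤n⇒∃[o]m+o≡n 2s≤n
... | c , refl rewrite e-Gs-parts s c = combine (e (K s)) (e (K c)) (e-K s) (e-K c)
  where
  open ≡-Reasoning
  combine : ∀ x y → 2 * x + s ≡ s * s → 2 * y + c ≡ c * c →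
    2 * (x + s * (c + s) + y) + 2 * (2 * s + c) * s + (2 * s + c) ≡ (2 * s + c) * (2 * s + c) + s * (3 * s + 1)
  combine x y 2x+s≡s² 2y+c≡c² = begin
    2 * (x + s * (c + s) + y) + 2 * (2 * s + c) * s + (2 * s + c)  ≡⟨ solve (x ∷ y ∷ s ∷ c ∷ []) ⟩
    (2 * x + s) + (2 * y + c) + s * (6 * s + 4 * c + 1)            ≡⟨ cong₂ (λ u v → u + v + s * (6 * s + 4 * c + 1)) 2x+s≡s² 2y+c≡c² ⟩
    s * s + c * c + s * (6 * s + 4 * c + 1)                        ≡⟨ solve (s ∷ c ∷ []) ⟩
    (2 * s + c) * (2 * s + c) + s * (3 * s + 1)                    ∎

-- 2e(G_t) − 2e(G_s) = (t − s)(3(s + t) + 1 − 2n), with both sides moved so that no subtraction occurs.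
e-Gs-difference : ∀ {n s t} → s ≤ t → 2 * t ≤ n →
  2 * e (Gs n t) + (t ∸ s) * (2 * n) ≡ 2 * e (Gs n s) + (t ∸ s) * (3 * (s + t) + 1)
e-Gs-difference {n} {s} s≤t 2t≤n with m≤n⇒∃[o]m+o≡n s≤t
... | k , refl rewrite m+n∸m≡n s k =
  +-cancelʳ-≡ (2 * n * s + n) _ _ (shift (2 * e (Gs n (s + k))) (2 * e (Gs n s)) (e-Gs 2t≤n) (e-Gs 2s≤n))
  where
  open ≡-Reasoning
  2s≤n : 2 * s ≤ n
  2s≤n = ≤-trans (*-monoʳ-≤ 2 (m≤m+n s k)) 2t≤n
  shift : ∀ x y → x + 2 * n * (s + k) + n ≡ n * n + (s + k) * (3 * (s + k) + 1) →
                  y + 2 * n * s + n ≡ n * n + s * (3 * s + 1) →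
          x + k * (2 * n) + (2 * n * s + n) ≡ y + k * (3 * (s + (s + k)) + 1) + (2 * n * s + n)
  shift x y x-identity y-identity = begin
    x + k * (2 * n) + (2 * n * s + n)                      ≡⟨ solve (x ∷ k ∷ n ∷ s ∷ []) ⟩
    x + 2 * n * (s + k) + n                                ≡⟨ x-identity ⟩
    n * n + (s + k) * (3 * (s + k) + 1)                    ≡⟨ solve (n ∷ s ∷ k ∷ []) ⟩
    n * n + s * (3 * s + 1) + k * (3 * (s + (s + k)) + 1)  ≡⟨ cong (_+ k * (3 * (s + (s + k)) + 1)) (sym y-identity) ⟩
    y + 2 * n * s + n + k * (3 * (s + (s + k)) + 1)        ≡⟨ solve (y ∷ n ∷ s ∷ k ∷ []) ⟩
    y + k * (3 * (s + (s + k)) + 1) + (2 * n * s + n)      ∎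

m+o≡n+p∧p<o⇒m<n : ∀ {m n o p} → m + o ≡ n + p → p < o → m < n
m+o≡n+p∧p<o⇒m<n {m} {n} {o} {p} m+o≡n+p p<o = +-cancelʳ-< p m n (<-≤-trans (+-monoʳ-< m p<o) (≤-reflexive m+o≡n+p))

e-Gs-< : ∀ {n s t} → s < t → 2 * t ≤ n → 3 * (s + t) + 1 < 2 * n → e (Gs n t) < e (Gs n s)
e-Gs-< {s = s} {t} s<t 2t≤n w<2n = *-cancelˡ-< 2 _ _
  (m+o≡n+p∧p<o⇒m<n (e-Gs-difference (<⇒≤ s<t) 2t≤n) (*-monoʳ-< (t ∸ s) {{>-nonZero (m<n⇒0<n∸m s<t)}} w<2n))

e-Gs-> : ∀ {n s t} → s < t → 2 * t ≤ n → 2 * n < 3 * (s + t) + 1 → e (Gs n s) < e (Gs n t)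
e-Gs-> {s = s} {t} s<t 2t≤n 2n<w = *-cancelˡ-< 2 _ _
  (m+o≡n+p∧p<o⇒m<n (sym (e-Gs-difference (<⇒≤ s<t) 2t≤n)) (*-monoʳ-< (t ∸ s) {{>-nonZero (m<n⇒0<n∸m s<t)}} 2n<w))

e-Gs-≡ : ∀ {n s t} → s ≤ t → 2 * t ≤ n → 3 * (s + t) + 1 ≡ 2 * n → e (Gs n s) ≡ e (Gs n t)
e-Gs-≡ {n} {s} {t} s≤t 2t≤n w≡2n = *-cancelˡ-≡ _ _ 2 (+-cancelʳ-≡ ((t ∸ s) * (2 * n)) _ _
  (trans (cong (λ z → 2 * e (Gs n s) + (t ∸ s) * z) (sym w≡2n)) (sym (e-Gs-difference s≤t 2t≤n))))

record _IsHalfOf_ (m n : ℕ) : Set where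
  constructor halfBounds
  field
    2*half≤ : 2 * m ≤ n
    ≤2*half+1 : n ≤ 2 * m + 1

n/2-IsHalfOf : ∀ n → (n / 2) IsHalfOf n
n/2-IsHalfOf n = halfBounds (subst (_≤ n) (*-comm (n / 2) 2) (m/n*n≤m n 2)) (begin
    n                  ≡⟨ m≡m%n+[m/n]*n n 2 ⟩
    n % 2 + n / 2 * 2  ≤⟨ +-monoˡ-≤ (n / 2 * 2) (m<1+n⇒m≤n (m%n<n n 2)) ⟩
    1 + n / 2 * 2      ≡⟨ trans (+-comm 1 _) (cong (_+ 1) (*-comm (n / 2) 2)) ⟩
    2 * (n / 2) + 1    ∎)
  where open ≤-Reasoning

even-IsHalfOf : ∀ {n k} → n ≡ 2 * k → k IsHalfOf n
even-IsHalfOf {k = k} refl = halfBounds ≤-refl (m≤m+n (2 * k) 1)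

odd-IsHalfOf : ∀ {n k} → n ≡ 2 * k + 1 → k IsHalfOf n
odd-IsHalfOf {k = k} refl = halfBounds (m≤m+n (2 * k) 1) ≤-refl

2*m≤2*n+1⇒m≤n : ∀ {m n} → 2 * m ≤ 2 * n + 1 → m ≤ n
2*m≤2*n+1⇒m≤n {m} {n} 2m≤2n+1 = m<1+n⇒m≤n (*-cancelˡ-< 2 m (suc n) (≤-trans (s≤s 2m≤2n+1) (≤-reflexive (solve (n ∷ [])))))

IsHalfOf-unique : ∀ {m k n} → m IsHalfOf n → k IsHalfOf n → m ≡ k
IsHalfOf-unique (halfBounds 2m≤n n≤2m+1) (halfBounds 2k≤n n≤2k+1) =
  ≤-antisym (2*m≤2*n+1⇒m≤n (≤-trans 2m≤n n≤2k+1)) (2*m≤2*n+1⇒m≤n (≤-trans 2k≤n n≤2m+1))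

6*[1+d]∸1≡6*d+5 : ∀ d → 6 * suc d ∸ 1 ≡ 6 * d + 5
6*[1+d]∸1≡6*d+5 d = cong pred {6 * suc d} {suc (6 * d + 5)} (solve (d ∷ []))

threshold-i : ∀ δ {n m} → m IsHalfOf n → (6 * δ + 2 < n ⊎ n ≡ 6 * δ + 1) → 3 * (δ + m) + 1 < 2 * n
threshold-i δ {n} {m} (halfBounds 2m≤n _) (inj₁ 6δ+2<n) = *-cancelˡ-< 2 _ _ (begin-strict
    2 * (3 * (δ + m) + 1)      ≡⟨ solve (δ ∷ m ∷ []) ⟩
    (6 * δ + 2) + 3 * (2 * m)  <⟨ +-mono-<-≤ 6δ+2<n (*-monoʳ-≤ 3 2m≤n) ⟩
    n + 3 * n                  ≡⟨ solve (n ∷ []) ⟩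
    2 * (2 * n)                ∎)
  where open ≤-Reasoning
threshold-i δ half (inj₂ refl) with IsHalfOf-unique half (odd-IsHalfOf {6 * δ + 1} {3 * δ} (solve (δ ∷ [])))
... | refl = ≤-reflexive (solve (δ ∷ []))

threshold-ii : ∀ δ {n m} → 1 ≤ δ → m IsHalfOf n → (n ≡ 6 * δ + 2 ⊎ n ≡ 6 * δ ∸ 1) → δ ≤ m × 3 * (δ + m) + 1 ≡ 2 * n
threshold-ii δ _ half (inj₁ refl) with IsHalfOf-unique half (even-IsHalfOf {6 * δ + 2} {3 * δ + 1} (solve (δ ∷ [])))
... | refl = ≤-trans (m≤m+n δ (2 * δ + 1)) (≤-reflexive (solve (δ ∷ []))) , solve (δ ∷ [])
threshold-ii (suc d) (s≤s z≤n) half (inj₂ n≡6δ∸1) with trans n≡6δ∸1 (6*[1+d]∸1≡6*d+5 d)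
... | refl with IsHalfOf-unique half (odd-IsHalfOf {6 * d + 5} {3 * d + 2} (solve (d ∷ [])))
... | refl = ≤-trans (m≤m+n (suc d) (2 * d + 1)) (≤-reflexive (solve (d ∷ []))) , solve (d ∷ [])

threshold-iii : ∀ δ {n m} → m IsHalfOf n → (n < 6 * δ ∸ 1 ⊎ n ≡ 6 * δ) → 2 * n < 3 * (δ + m) + 1
threshold-iii zero _ (inj₁ ())
threshold-iii (suc d) {n} {m} (halfBounds _ n≤2m+1) (inj₁ n<6δ∸1) = *-cancelˡ-< 2 _ _ (begin-strict
    2 * (2 * n)                    ≡⟨ solve (n ∷ []) ⟩
    n + 3 * n                      <⟨ +-mono-<-≤ n<6d+5 (*-monoʳ-≤ 3 n≤2m+1) ⟩
    (6 * d + 5) + 3 * (2 * m + 1)  ≡⟨ solve (d ∷ m ∷ []) ⟩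
    2 * (3 * (suc d + m) + 1)      ∎)
  where
  open ≤-Reasoning
  n<6d+5 : n < 6 * d + 5
  n<6d+5 = subst (n <_) (6*[1+d]∸1≡6*d+5 d) n<6δ∸1
threshold-iii δ half (inj₂ refl) with IsHalfOf-unique half (even-IsHalfOf {6 * δ} {3 * δ} (solve (δ ∷ [])))
... | refl = ≤-reflexive (solve (δ ∷ []))

lemma2p8 : (n δ : ℕ) → 1 ≤ n → 1 ≤ δ →
    ((6 * δ + 2 < n ⊎ n ≡ 6 * δ + 1) →
      (s : ℕ) → δ < s → s ≤ n / 2 → e (Gs n s) < e (Gs n δ))
    × ((n ≡ 6 * δ + 2 ⊎ n ≡ 6 * δ ∸ 1) →
      (e (Gs n δ) ≡ e (Gs n (n / 2)))
        × ((s : ℕ) → δ < s → s < n / 2 → e (Gs n s) < e (Gs n δ)))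
    × ((n < 6 * δ ∸ 1 ⊎ n ≡ 6 * δ) →
      (s : ℕ) → δ ≤ s → s < n / 2 → e (Gs n s) < e (Gs n (n / 2)))
lemma2p8 n δ _ 1≤δ =
    (λ hyp s δ<s s≤m → e-Gs-< δ<s (double≤n s≤m) (≤-<-trans (3[s+t]+1-mono-≤ (≤-refl {δ}) s≤m) (threshold-i δ half hyp)))
  , (λ hyp → let δ≤m , w≡2n = threshold-ii δ 1≤δ half hyp in
        e-Gs-≡ δ≤m (double≤n ≤-refl) w≡2n
      , λ s δ<s s<m → e-Gs-< δ<s (double≤n (<⇒≤ s<m)) (<-≤-trans (3[δ+s]+1-monoʳ-< s<m) (≤-reflexive w≡2n)))
  , (λ hyp s δ≤s s<m → e-Gs-> s<m (double≤n ≤-refl) (<-≤-trans (threshold-iii δ half hyp) (3[s+t]+1-mono-≤ δ≤s (≤-refl {n / 2}))))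
  where
  half : (n / 2) IsHalfOf n
  half = n/2-IsHalfOf n
  double≤n : ∀ {s} → s ≤ n / 2 → 2 * s ≤ n
  double≤n s≤m = ≤-trans (*-monoʳ-≤ 2 s≤m) (_IsHalfOf_.2*half≤ half)
  3[s+t]+1-mono-≤ : ∀ {s t u v} → s ≤ u → t ≤ v → 3 * (s + t) + 1 ≤ 3 * (u + v) + 1
  3[s+t]+1-mono-≤ s≤u t≤v = +-monoˡ-≤ 1 (*-monoʳ-≤ 3 (+-mono-≤ s≤u t≤v))
  3[δ+s]+1-monoʳ-< : ∀ {s} → s < n / 2 → 3 * (δ + s) + 1 < 3 * (δ + n / 2) + 1
  3[δ+s]+1-monoʳ-< s<m = +-monoˡ-< 1 (*-monoʳ-< 3 (+-monoʳ-< δ s<m))
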